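{- Let $n\ge1$, let $A$ be a finite abelian group, and let $G=\mathbb{Z}/n\mathbb{Z}\rtimes_\varphi A$ for some homomorphism $\varphi\colon A\to\operatorname{Aut}(\mathbb{Z}/n\mathbb{Z})$. Then for every subgroup $H\le G$ containing $A$ (i.e., the subgroup $\{0\}\times A$), the set $\{\#K:H\le K\le G\}$ equals the set of positive integers $m$ with $\#H\mid m\mid\#G$. The same conclusion holds for every subgroup $H\le G$ whose projection onto $A$ is trivial. -}

module Defs where

open import Data.Nat using (ℕ; NonZero; _∸_) renaming (_+_ to _+ℕ_)
open import Data.Nat.DivMod using (_mod_)
open import Data.Fin using (Fin; toℕ)
open import Data.Product using (_×_; _,_)
open import Data.Bool using (Bool; true; T; if_then_else_)
open import Data.List using (List; allFin; cartesianProduct; map)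
open import Data.Nat.ListAction using (sum)
open import Function.Definitions using (Bijective)
open import Relation.Binary.PropositionalEquality using (_≡_)
open import Algebra.Structures using (IsAbelianGroup)

module ZMod (n : ℕ) .{{_ : NonZero n}} where

  0ₙ : Fin n
  0ₙ = 0 mod n

  _+ₙ_ : Fin n → Fin n → Fin n
  x +ₙ y = (toℕ x +ℕ toℕ y) mod n

  -ₙ_ : Fin n → Fin n
  -ₙ x = (n ∸ toℕ x) mod n

  record IsAut (f : Fin n → Fin n) : Set where
    field
      additive  : ∀ x y → f (x +ₙ y) ≡ f x +ₙ f y
      bijective : Bijective _≡_ _≡_ f

open ZMod public using (IsAut)

-- A finite abelian group: an abelian group structure on Fin k
-- (every finite abelian group is isomorphic to one of these).

record FinAbGroup (k : ℕ) : Set where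
  field
    _∙_ : Fin k → Fin k → Fin k
    ε   : Fin k
    _⁻¹ : Fin k → Fin k
    isAbelianGroup : IsAbelianGroup _≡_ _∙_ ε _⁻¹

record AutHom (n : ℕ) .{{_ : NonZero n}} {k : ℕ} (A : FinAbGroup k) : Set where
  open FinAbGroup A
  field
    φ     : Fin k → Fin n → Fin n
    isAut : ∀ a → IsAut n (φ a)
    hom   : ∀ a b x → φ (a ∙ b) x ≡ φ a (φ b x)

module Semidirect (n : ℕ) .{{_ : NonZero n}} {k : ℕ}
                  (A : FinAbGroup k) (Φ : AutHom n A) where
  open FinAbGroup A
  open AutHom Φ
  open ZMod n using (0ₙ; _+ₙ_; -ₙ_)

  G : Set
  G = Fin n × Fin k

  _·_ : G → G → G
  (x , a) · (y , b) = (x +ₙ φ a y , a ∙ b)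

  e : G
  e = (0ₙ , ε)

  inv : G → G
  inv (x , a) = (-ₙ (φ (a ⁻¹) x) , a ⁻¹)

  -- Subsets of the finite set G (every subset of a finite set is decidable).
  SubsetG : Set
  SubsetG = G → Bool

  elems : List G
  elems = cartesianProduct (allFin n) (allFin k)

  card : SubsetG → ℕ
  card S = sum (map (λ g → if S g then 1 else 0) elems)

  record IsSubgroup (S : SubsetG) : Set where
    field
      has-e   : T (S e)
      mul-cl  : ∀ g h → T (S g) → T (S h) → T (S (g · h))
      inv-cl  : ∀ g → T (S g) → T (S (inv g))

  _⊆_ : SubsetG → SubsetG → Set
  S ⊆ S′ = ∀ g → T (S g) → T (S′ g)

  fullG : SubsetG
  fullG _ = true

  ContainsA : SubsetG → Set
  ContainsA H = ∀ a → T (H (0ₙ , a))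

  TrivialProjA : SubsetG → Set
  TrivialProjA H = ∀ x a → T (H (x , a)) → a ≡ ε

module Submission where

-- Let H₀ = {x : (x , ε) ∈ H}.  If H ⊇ A then H = H₀ ⊗ A, and if H
-- projects trivially to A then H = H₀ ⊗ {ε}.  An automorphism of ℤ/nℤ is
-- multiplication by a constant, so it maps every subgroup of ℤ/nℤ into
-- itself; hence N ⊗ B is a subgroup of G for all subgroups N ≤ ℤ/nℤ and
-- B ≤ A.  Given |H| ∣ m ∣ |G| = n |A|, elementary arithmetic writes
-- m = (|H₀| t)(|B| u) with |H₀| t ∣ n and |B| u ∣ |A|, and the converse of
-- Lagrange's theorem for finite abelian groups enlarges H₀ and B by the
-- factors t and u; the product of the enlargements is the overgroup.  The
-- other direction is Lagrange's theorem.

open import Defs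

open import Algebra.Bundles using (Group; AbelianGroup)
open import Algebra.Structures using (IsGroup; IsAbelianGroup)
import Algebra.Properties.AbelianGroup as AbelianGroupProperties
import Algebra.Properties.CommutativeSemigroup as CommutativeSemigroupProperties
import Algebra.Properties.Group as GroupProperties
import Algebra.Properties.Monoid.Mult as MonoidMultiples
open import Data.Bool using (Bool; true; false; T; not; _∧_; _∨_; if_then_else_)
open import Data.Bool.Properties using (T-∨)
open import Data.Empty using (⊥; ⊥-elim)
open import Data.Fin using (Fin; toℕ)
open import Data.Fin.Properties using (pigeonhole; toℕ-fromℕ<; toℕ<n; toℕ-injective) renaming (_≟_ to _≟ᶠ_)
open import Data.List using (List; []; _∷_; _++_; map; cartesianProduct; length; lookup; allFin)
open import Data.List.Membership.Propositional using (_∈_)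
open import Data.List.Membership.Propositional.Properties using (∈-map⁺; ∈-allFin; ∈-cartesianProduct⁺)
open import Data.List.Membership.Propositional.Properties.WithK using (unique∧set⇒bag)
open import Data.List.Relation.Binary.BagAndSetEquality using (∼bag⇒↭)
open import Data.List.Relation.Binary.Permutation.Propositional using (_↭_)
import Data.List.Relation.Binary.Permutation.Propositional.Properties as Perm
open import Data.List.Relation.Unary.All using (All; []; _∷_)
import Data.List.Relation.Unary.All as All
open import Data.List.Relation.Unary.Any using (here; there)
import Data.List.Relation.Unary.Any as Any
open import Data.List.Relation.Unary.Any.Properties using (lookup-index)
open import Data.List.Relation.Unary.Unique.Propositional using (Unique; _∷_)
import Data.List.Relation.Unary.Unique.Propositional.Properties as Unique
open import Data.Nat using (ℕ; zero; suc; _+_; _*_; _∸_; _≤_; _<_; _≥_; z≤n; s≤s; z<s; NonZero; >-nonZero; ≢-nonZero; ≢-nonZero⁻¹; nonTrivial⇒n>1)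
open import Data.Nat.Divisibility
  using (_∣_; divides; _∣?_; ∣-refl; ∣-trans; _∣0; 0∣⇒≡0; ∣m∣n⇒∣m+n; *-monoˡ-∣; *-monoʳ-∣; *-cancelˡ-∣; ∣⇒≤; m∣m*n; *-cancelʳ-∣; ∣1⇒≡1)
open import Data.Nat.Coprimality as Coprime using (Coprime; coprime-divisor; coprime-Bézout; prime⇒coprime)
open import Data.Nat.GCD using (module Bézout; gcd; gcd[m,n]∣m; gcd[m,n]∣n; gcd-greatest; gcd[m,n]≢0)
open import Data.Nat.Primality using (Prime; prime⇒nonTrivial; prime⇒irreducible)
open import Data.Nat.Primality.Factorisation using (PrimeFactorisation; factorise)
open import Data.Nat.ListAction using (sum; product)
open import Data.Nat.ListAction.Properties using (sum-↭)
open import Data.Nat.Properties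
open import Data.Nat.DivMod
  using (_%_; _/_; _mod_; m%n<n; m≡m%n+[m/n]*n; m%n≤m; m<n⇒m%n≡m; %-distribˡ-+; m%n%n≡m%n; n%n≡0)
open import Data.Product using (Σ; _×_; _,_; proj₁; proj₂)
open import Data.Sum using (_⊎_; inj₁; inj₂; [_,_]′)
open import Function.Bundles using (_⇔_; mk⇔; Equivalence)
open import Relation.Nullary using (¬_; yes; no)
open import Relation.Nullary.Decidable using (⌊_⌋; toWitness; fromWitness)
open import Relation.Binary.Definitions using (DecidableEquality)
open import Function.Base using (id)
open import Relation.Binary.PropositionalEquality

T-∧ : ∀ {a b} → T a → T b → T (a ∧ b)
T-∧ {true} {true} _ _ = _

T-∧ˡ : ∀ {a b} → T (a ∧ b) → T a
T-∧ˡ {true} _ = _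

T-∧ʳ : ∀ {a b} → T (a ∧ b) → T b
T-∧ʳ {true} {true} _ = _

T-not : ∀ {a} → ¬ T a → T (not a)
T-not {true}  ¬a = ¬a _
T-not {false} _  = _

T-not⁻¹ : ∀ {a} → T (not a) → ¬ T a
T-not⁻¹ {true} ()

T-ext : ∀ {a b} → (T a → T b) → (T b → T a) → a ≡ b
T-ext {true}  {true}  _ _ = refl
T-ext {true}  {false} f _ = ⊥-elim (f _)
T-ext {false} {true}  _ g = ⊥-elim (g _)
T-ext {false} {false} _ _ = refl

indicator : Bool → ℕ
indicator b = if b then 1 else 0

cnt : {X : Set} → List X → (X → Bool) → ℕ
cnt L S = sum (map (λ x → indicator (S x)) L)

module _ {X : Set} where

  cnt-cong : (L : List X) {S S′ : X → Bool} → (∀ x → S x ≡ S′ x) → cnt L S ≡ cnt L S′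
  cnt-cong []      eq = refl
  cnt-cong (x ∷ L) eq = cong₂ (λ b c → indicator b + c) (eq x) (cnt-cong L eq)

  cnt-mono : (L : List X) {S S′ : X → Bool} → (∀ x → T (S x) → T (S′ x)) → cnt L S ≤ cnt L S′
  cnt-mono []      f = z≤n
  cnt-mono (x ∷ L) {S} {S′} f with S x | S′ x | f x
  ... | true  | true  | _ = s≤s (cnt-mono L f)
  ... | true  | false | g = ⊥-elim (g _)
  ... | false | true  | _ = m≤n⇒m≤1+n (cnt-mono L f)
  ... | false | false | _ = cnt-mono L f

  cnt-pos : (L : List X) (S : X → Bool) {x : X} → x ∈ L → T (S x) → 1 ≤ cnt L S
  cnt-pos (y ∷ L) S (here refl) Sy with S y
  ... | true = s≤s z≤n
  cnt-pos (y ∷ L) S (there x∈L) Sx = ≤-trans (cnt-pos L S x∈L Sx) (m≤n+m _ (indicator (S y)))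

  cnt-none : (L : List X) {S : X → Bool} → All (λ x → ¬ T (S x)) L → cnt L S ≡ 0
  cnt-none []      []          = refl
  cnt-none (x ∷ L) {S} (¬Sx ∷ rest) with S x
  ... | true  = ⊥-elim (¬Sx _)
  ... | false = cnt-none L rest

  cnt-find : (L : List X) (S : X → Bool) → (Σ X λ x → x ∈ L × T (S x)) ⊎ cnt L S ≡ 0
  cnt-find []      S = inj₂ refl
  cnt-find (x ∷ L) S with S x in Sx≡
  ... | true = inj₁ (x , here refl , subst T (sym Sx≡) _)
  ... | false with cnt-find L S
  ...   | inj₁ (y , y∈L , Sy) = inj₁ (y , there y∈L , Sy)
  ...   | inj₂ none           = inj₂ none

  cnt-split : (L : List X) {S U : X → Bool} → (∀ x → T (U x) → T (S x)) →
              cnt L S ≡ cnt L U + cnt L (λ x → S x ∧ not (U x))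
  cnt-split []      U⊆S = refl
  cnt-split (x ∷ L) {S} {U} U⊆S with S x | U x | U⊆S x
  ... | true  | true  | _ = cong suc (cnt-split L U⊆S)
  ... | true  | false | _ = trans (cong suc (cnt-split L U⊆S)) (sym (+-suc _ _))
  ... | false | true  | f = ⊥-elim (f _)
  ... | false | false | _ = cnt-split L U⊆S

  cnt-∨ : (L : List X) {S U : X → Bool} → (∀ x → T (S x) → T (U x) → ⊥) →
          cnt L (λ x → S x ∨ U x) ≡ cnt L S + cnt L U
  cnt-∨ []      disj = refl
  cnt-∨ (x ∷ L) {S} {U} disj with S x | U x | disj x
  ... | true  | true  | d = ⊥-elim (d _ _)
  ... | true  | false | _ = cong suc (cnt-∨ L disj)
  ... | false | true  | _ = trans (cong suc (cnt-∨ L disj)) (sym (+-suc _ _))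
  ... | false | false | _ = cnt-∨ L disj

  cnt-++ : (L L′ : List X) (S : X → Bool) → cnt (L ++ L′) S ≡ cnt L S + cnt L′ S
  cnt-++ []      L′ S = refl
  cnt-++ (x ∷ L) L′ S = trans (cong (indicator (S x) +_) (cnt-++ L L′ S)) (sym (+-assoc (indicator (S x)) _ _))

  cnt-map : {Y : Set} (f : Y → X) (L : List Y) (S : X → Bool) → cnt (map f L) S ≡ cnt L (λ y → S (f y))
  cnt-map f []      S = refl
  cnt-map f (y ∷ L) S = cong (indicator (S (f y)) +_) (cnt-map f L S)

  cnt-↭ : {L L′ : List X} (S : X → Bool) → L ↭ L′ → cnt L S ≡ cnt L′ S
  cnt-↭ S p = sum-↭ (Perm.map⁺ (λ x → indicator (S x)) p)

  cnt-singleton : (_≟_ : DecidableEquality X) (L : List X) {x : X} → Unique L → x ∈ L →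
                  cnt L (λ y → ⌊ y ≟ x ⌋) ≡ 1
  cnt-singleton _≟_ (y ∷ L) (y∉L ∷ _) (here refl) with y ≟ y
  ... | no y≢y = ⊥-elim (y≢y refl)
  ... | yes _  = cong suc (cnt-none L (All.map (λ y≢z z≡y → y≢z (sym (toWitness z≡y))) y∉L))
  cnt-singleton _≟_ (y ∷ L) {x} (y∉L ∷ unique) (there x∈L) with y ≟ x
  ... | yes refl = ⊥-elim (All.lookup y∉L x∈L refl)
  ... | no _     = cnt-singleton _≟_ L unique x∈L

cnt-× : {X Y : Set} (xs : List X) (ys : List Y) (P : X → Bool) (Q : Y → Bool) →
        cnt (cartesianProduct xs ys) (λ p → P (proj₁ p) ∧ Q (proj₂ p)) ≡ cnt xs P * cnt ys Q
cnt-× [] ys P Q = refl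
cnt-× {X} {Y} (x ∷ xs) ys P Q = begin
  cnt (map (x ,_) ys ++ cartesianProduct xs ys) R
    ≡⟨ cnt-++ (map (x ,_) ys) _ R ⟩
  cnt (map (x ,_) ys) R + cnt (cartesianProduct xs ys) R
    ≡⟨ cong₂ _+_ (cnt-map (x ,_) ys R) (cnt-× xs ys P Q) ⟩
  cnt ys (λ y → P x ∧ Q y) + cnt xs P * cnt ys Q
    ≡⟨ cong (_+ cnt xs P * cnt ys Q) (row (P x)) ⟩
  indicator (P x) * cnt ys Q + cnt xs P * cnt ys Q
    ≡⟨ *-distribʳ-+ (cnt ys Q) (indicator (P x)) _ ⟨
  (indicator (P x) + cnt xs P) * cnt ys Q ∎
  where
  open ≡-Reasoning
  R : X × Y → Bool
  R p = P (proj₁ p) ∧ Q (proj₂ p)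
  row : ∀ b → cnt ys (λ y → b ∧ Q y) ≡ indicator b * cnt ys Q
  row true  = sym (+-identityʳ _)
  row false = cnt-none ys (All.universal (λ _ ()) ys)

least-below : (P : ℕ → Bool) (b : ℕ) →
              (Σ ℕ λ i → i < b × T (P i) × (∀ j → j < i → ¬ T (P j))) ⊎ (∀ j → j < b → ¬ T (P j))
least-below P zero = inj₂ (λ _ ())
least-below P (suc b) with least-below P b
... | inj₁ (i , i<b , Pi , below) = inj₁ (i , m<n⇒m<1+n i<b , Pi , below)
... | inj₂ none with P b in Pb≡
...   | true  = inj₁ (b , ≤-refl , subst T (sym Pb≡) _ , none)
...   | false = inj₂ λ j j<1+b → [ none j , (λ { refl → subst T Pb≡ }) ]′ (m<1+n⇒m<n∨m≡n j<1+b)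

prime>1 : ∀ {p} → Prime p → 1 < p
prime>1 {p} pp = nonTrivial⇒n>1 p {{prime⇒nonTrivial pp}}

coprime-combine : ∀ r c p s → .{{NonZero c}} → Coprime r p → r * c ∣ s → c * p ∣ s → r * c * p ∣ s
coprime-combine r c p s r⊥p (divides u refl) cp∣urc =
  subst (_∣ u * (r * c)) (*-comm p (r * c)) (*-monoˡ-∣ (r * c) p∣u)
  where
  regroup : u * (r * c) ≡ c * (r * u)
  regroup = trans (*-comm u (r * c)) (trans (cong (_* u) (*-comm r c)) (*-assoc c r u))
  p∣u : p ∣ u
  p∣u = coprime-divisor (Coprime.sym r⊥p) (*-cancelˡ-∣ c (subst (c * p ∣_) regroup cp∣urc))

cancel-factor : ∀ {h m a b} → .{{NonZero b}} → h * b ∣ m → m ∣ a * b → Σ ℕ λ w → h * w ∣ a × m ≡ h * w * b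
cancel-factor {h} {a = a} {b} (divides w refl) whb∣ab = w , hw∣a , regroup
  where
  regroup : w * (h * b) ≡ h * w * b
  regroup = trans (sym (*-assoc w h b)) (cong (_* b) (*-comm w h))
  hw∣a : h * w ∣ a
  hw∣a = *-cancelʳ-∣ b (subst (_∣ a * b) regroup whb∣ab)

-- If h ∣ m, h ∣ a and m ∣ a b with m ≠ 0, then m = h t c with h t ∣ a and
-- c ∣ b: take h t = gcd(m, a) and c = m / gcd(m, a), which is coprime to
-- a / gcd(m, a).
split-divisor : ∀ {h m a b} → 0 < m → h ∣ m → h ∣ a → m ∣ a * b →
                Σ ℕ λ t → Σ ℕ λ c → h * t ∣ a × c ∣ b × m ≡ h * t * c
split-divisor {h} {m} {a} {b} 0<m h∣m h∣a m∣ab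
  with gcd[m,n]∣m m a | gcd[m,n]∣n m a | gcd-greatest h∣m h∣a
... | divides c m≡cg | divides d a≡dg | divides t g≡th =
  t , c , subst (_∣ a) g≡ht (gcd[m,n]∣n m a) , c∣b , trans m≡cg (trans (*-comm c g) (cong (_* c) g≡ht))
  where
  g : ℕ
  g = gcd m a
  g≡ht : g ≡ h * t
  g≡ht = trans g≡th (*-comm t h)
  instance
    g≢0 : NonZero g
    g≢0 = ≢-nonZero (gcd[m,n]≢0 m a (inj₁ (≢-nonZero⁻¹ m {{>-nonZero 0<m}})))
  c⊥d : Coprime c d
  c⊥d {i} (i∣c , i∣d) = ∣1⇒≡1 (*-cancelʳ-∣ g (subst (i * g ∣_) (sym (*-identityˡ g))
    (gcd-greatest (subst (i * g ∣_) (sym m≡cg) (*-monoˡ-∣ g i∣c)) (subst (i * g ∣_) (sym a≡dg) (*-monoˡ-∣ g i∣d)))))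
  regroup : a * b ≡ d * b * g
  regroup = trans (cong (_* b) a≡dg) (trans (*-assoc d g b) (trans (cong (d *_) (*-comm g b)) (sym (*-assoc d b g))))
  c∣b : c ∣ b
  c∣b = coprime-divisor c⊥d (*-cancelʳ-∣ g (subst₂ _∣_ m≡cg regroup m∣ab))

isGroup-≡ : {X : Set} {_∙_ : X → X → X} {ε : X} {_⁻¹ : X → X} →
            (∀ x y z → (x ∙ y) ∙ z ≡ x ∙ (y ∙ z)) →
            (∀ x → ε ∙ x ≡ x) → (∀ x → x ∙ ε ≡ x) →
            (∀ x → (x ⁻¹) ∙ x ≡ ε) → (∀ x → x ∙ (x ⁻¹) ≡ ε) → IsGroup _≡_ _∙_ ε _⁻¹
isGroup-≡ {_∙_ = _∙_} {_⁻¹ = _⁻¹} assoc idˡ idʳ invˡ invʳ = record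
  { isMonoid = record
    { isSemigroup = record { isMagma = record { isEquivalence = isEquivalence ; ∙-cong = cong₂ _∙_ } ; assoc = assoc }
    ; identity    = idˡ , idʳ }
  ; inverse = invˡ , invʳ
  ; ⁻¹-cong = cong _⁻¹ }

record FinGroup : Set₁ where
  infixl 7 _∙_
  infix  8 _⁻¹
  field
    Carrier        : Set
    _∙_            : Carrier → Carrier → Carrier
    ε              : Carrier
    _⁻¹            : Carrier → Carrier
    isGroup        : IsGroup _≡_ _∙_ ε _⁻¹
    elems          : List Carrier
    elems-unique   : Unique elems
    elems-complete : ∀ x → x ∈ elems

module FinGroupTheory (𝔾 : FinGroup) where
  open FinGroup 𝔾 public

  group : Group _ _
  group = record { isGroup = isGroup }

  open IsGroup isGroup public using (assoc; identityʳ; inverseʳ)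
  open GroupProperties group public
    using (∙-cancelˡ; ε⁻¹≈ε; ⁻¹-involutive; inverseʳ-unique; \\-leftDividesˡ; \\-leftDividesʳ; //-rightDividesˡ; //-rightDividesʳ)
  open MonoidMultiples (Group.monoid group) using (×-homo-+; ×-assocˡ) renaming (_×_ to _·×_)

  infixr 8 _^_
  _^_ : Carrier → ℕ → Carrier
  g ^ i = i ·× g

  ^-+ : ∀ g i j → g ^ (i + j) ≡ g ^ i ∙ g ^ j
  ^-+ g i j = ×-homo-+ g i j

  ^-* : ∀ g i j → (g ^ i) ^ j ≡ g ^ (j * i)
  ^-* g i j = ×-assocˡ g j i

  Subset : Set
  Subset = Carrier → Bool

  card : Subset → ℕ
  card S = cnt elems S

  _⊆_ : Subset → Subset → Set
  S ⊆ S′ = ∀ g → T (S g) → T (S′ g)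

  record IsSubgroup (S : Subset) : Set where
    field
      has-e  : T (S ε)
      mul-cl : ∀ g h → T (S g) → T (S h) → T (S (g ∙ h))
      inv-cl : ∀ g → T (S g) → T (S (g ⁻¹))

  full : Subset
  full _ = true

  full-subgroup : IsSubgroup full
  full-subgroup = record { has-e = _ ; mul-cl = λ _ _ _ _ → _ ; inv-cl = λ _ _ → _ }

  ∈-resp : ∀ (S : Subset) {g h} → g ≡ h → T (S g) → T (S h)
  ∈-resp S refl Sg = Sg

  ^-closed : ∀ {S} → IsSubgroup S → ∀ g i → T (S g) → T (S (g ^ i))
  ^-closed sS g zero    Sg = IsSubgroup.has-e sS
  ^-closed sS g (suc i) Sg = IsSubgroup.mul-cl sS _ _ Sg (^-closed sS g i Sg)

  card-pos : ∀ (S : Subset) {x} → T (S x) → 1 ≤ card S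
  card-pos S {x} = cnt-pos elems S (elems-complete x)

  card-mono : ∀ {S S′} → S ⊆ S′ → card S ≤ card S′
  card-mono = cnt-mono elems

  -- Left translation by x permutes the elements, so it preserves cardinality.
  card-translate : ∀ x (S : Subset) → card (λ g → S (x ∙ g)) ≡ card S
  card-translate x S = begin
    cnt elems (λ g → S (x ∙ g)) ≡⟨ cnt-map (x ∙_) elems S ⟨
    cnt (map (x ∙_) elems) S    ≡⟨ cnt-↭ S (∼bag⇒↭ (unique∧set⇒bag translated-unique elems-unique same-elements)) ⟩
    cnt elems S                 ∎
    where
    open ≡-Reasoning
    translated-unique : Unique (map (x ∙_) elems)
    translated-unique = Unique.map⁺ (∙-cancelˡ x _ _) elems-unique
    same-elements : ∀ {y} → y ∈ map (x ∙_) elems ⇔ y ∈ elems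
    same-elements {y} = mk⇔ (λ _ → elems-complete y)
      (λ _ → subst (_∈ map (x ∙_) elems) (\\-leftDividesˡ x y) (∈-map⁺ (x ∙_) (elems-complete (x ⁻¹ ∙ y))))

  -- Y is a union of left cosets of H: closed under right multiplication by H.
  CosetUnion : Subset → Subset → Set
  CosetUnion H Y = ∀ y h → T (Y y) → T (H h) → T (Y (y ∙ h))

  coset : Carrier → Subset → Subset
  coset x H g = H (x ⁻¹ ∙ g)

  -- A union of left cosets of H has cardinality divisible by |H|: split off
  -- one coset, which has exactly |H| elements, and recurse on the rest.
  -- The bound on card Y drives the recursion.
  card-coset-union : ∀ bound {H Y} → IsSubgroup H → CosetUnion H Y → card Y ≤ bound → card H ∣ card Y
  card-coset-union bound {H} {Y} sH closed Y≤ with cnt-find elems Y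
  ... | inj₂ Y-empty = subst (card H ∣_) (sym Y-empty) (card H ∣0)
  card-coset-union zero {Y = Y} sH closed Y≤ | inj₁ (x , _ , Yx) with ≤-trans (card-pos Y Yx) Y≤
  ... | ()
  card-coset-union (suc bound) {H} {Y} sH closed Y≤ | inj₁ (x , _ , Yx) =
    subst (card H ∣_) (sym split) (∣m∣n⇒∣m+n (subst (card H ∣_) (sym coset-size) ∣-refl) rest-divisible)
    where
    open IsSubgroup sH
    xH⊆Y : coset x H ⊆ Y
    xH⊆Y g Hx⁻¹g = ∈-resp Y (\\-leftDividesˡ x g) (closed x _ Yx Hx⁻¹g)
    rest : Subset
    rest g = Y g ∧ not (coset x H g)
    split : card Y ≡ card (coset x H) + card rest
    split = cnt-split elems xH⊆Y
    coset-size : card (coset x H) ≡ card H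
    coset-size = card-translate (x ⁻¹) H
    rest-closed : CosetUnion H rest
    rest-closed y h rest-y Hh = T-∧ (closed y h (T-∧ˡ rest-y) Hh) (T-not λ Hx⁻¹yh →
      T-not⁻¹ (T-∧ʳ {Y y} rest-y)
        (∈-resp H (//-rightDividesʳ h (x ⁻¹ ∙ y))
          (mul-cl _ _ (∈-resp H (sym (assoc (x ⁻¹) y h)) Hx⁻¹yh) (inv-cl h Hh))))
    rest-bound : card rest ≤ bound
    rest-bound = ≤-pred (≤-trans (+-monoˡ-≤ (card rest) (≤-trans (card-pos H has-e) (≤-reflexive (sym coset-size))))
                                 (subst (_≤ suc bound) split Y≤))
    rest-divisible : card H ∣ card rest
    rest-divisible = card-coset-union bound sH rest-closed rest-bound

  lagrange : ∀ {H K} → IsSubgroup H → IsSubgroup K → H ⊆ K → card H ∣ card K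
  lagrange {K = K} sH sK H⊆K =
    card-coset-union (card K) sH (λ y h Ky Hh → IsSubgroup.mul-cl sK y h Ky (H⊆K h Hh)) ≤-refl

  index : Carrier → Fin (length elems)
  index x = Any.index (elems-complete x)

  index-injective : ∀ {x y} → index x ≡ index y → x ≡ y
  index-injective {x} {y} same = trans (lookup-index (elems-complete x))
    (trans (cong (lookup elems) same) (sym (lookup-index (elems-complete y))))

  -- Some positive power of g is ε: by pigeonhole, two of g^0, …, g^N coincide
  -- (N = |elems|), say g^i = g^j with i < j, and then g^(j-i) = ε.
  ε-power : ∀ g → Σ ℕ λ d → 0 < d × g ^ d ≡ ε
  ε-power g with pigeonhole (n<1+n _) (λ i → index (g ^ toℕ i))
  ... | i , j , i<j , same = toℕ j ∸ toℕ i , m<n⇒0<n∸m i<j , ∙-cancelˡ (g ^ toℕ i) _ _ cancel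
    where
    cancel : g ^ toℕ i ∙ g ^ (toℕ j ∸ toℕ i) ≡ g ^ toℕ i ∙ ε
    cancel = begin
      g ^ toℕ i ∙ g ^ (toℕ j ∸ toℕ i) ≡⟨ ^-+ g (toℕ i) _ ⟨
      g ^ (toℕ i + (toℕ j ∸ toℕ i))   ≡⟨ cong (g ^_) (m+[n∸m]≡n (<⇒≤ i<j)) ⟩
      g ^ toℕ j                       ≡⟨ index-injective same ⟨
      g ^ toℕ i                       ≡⟨ identityʳ _ ⟨
      g ^ toℕ i ∙ ε                   ∎
      where open ≡-Reasoning

  record OrderModulo (C : Subset) (g : Carrier) : Set where
    field
      pred-order : ℕ
    order : ℕ
    order = suc pred-order
    field
      power-in  : T (C (g ^ order))
      below-out : ∀ i → 0 < i → i < order → ¬ T (C (g ^ i))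

  -- The order modulo C exists: the least i ≥ 1 with g^i ∈ C exists
  -- because some g^d = ε ∈ C with d ≥ 1.
  orderModulo : ∀ {C} → IsSubgroup C → ∀ g → OrderModulo C g
  orderModulo {C} sC g with ε-power g
  ... | suc d , _ , gᵈ⁺¹≡ε with least-below (λ i → C (g ^ suc i)) (suc d)
  ...   | inj₁ (i , _ , in-C , below) = record { pred-order = i ; power-in = in-C ; below-out = out }
    where
    out : ∀ j → 0 < j → j < suc i → ¬ T (C (g ^ j))
    out (suc j) _ (s≤s j<i) = below j j<i
  ...   | inj₂ none = ⊥-elim (none d ≤-refl (∈-resp C (sym gᵈ⁺¹≡ε) (IsSubgroup.has-e sC)))

  order>1 : ∀ {C g} → ¬ T (C g) → (o : OrderModulo C g) → 1 < OrderModulo.order o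
  order>1 {C} {g} ¬Cg o with OrderModulo.pred-order o | OrderModulo.power-in o
  ... | zero    | Cg¹ = ⊥-elim (¬Cg (∈-resp C (identityʳ g) Cg¹))
  ... | suc _   | _   = s≤s (s≤s z≤n)

  successor-power : ∀ {D} → IsSubgroup D → ∀ g v → T (D (g ^ suc v)) → T (D (g ^ v)) → T (D g)
  successor-power {D} sD g v Dgᵛ⁺¹ Dgᵛ =
    ∈-resp D (//-rightDividesʳ (g ^ v) g) (IsSubgroup.mul-cl sD _ _ Dgᵛ⁺¹ (IsSubgroup.inv-cl sD _ Dgᵛ))

  ^-multiple : ∀ {D} → IsSubgroup D → ∀ g a x → T (D (g ^ a)) → T (D (g ^ (x * a)))
  ^-multiple {D} sD g a x Dgᵃ = ∈-resp D (^-* g a x) (^-closed sD _ x Dgᵃ)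

  -- Bézout: if g^a, g^b lie in a subgroup D and gcd(a, b) = 1, then g ∈ D.
  coprime-powers : ∀ {D} → IsSubgroup D → ∀ g a b → Coprime a b → T (D (g ^ a)) → T (D (g ^ b)) → T (D g)
  coprime-powers {D} sD g a b a⊥b Dgᵃ Dgᵇ with coprime-Bézout a⊥b
  ... | Bézout.+- x y eq =
    successor-power sD g (y * b) (∈-resp D (cong (g ^_) (sym eq)) (^-multiple sD g a x Dgᵃ)) (^-multiple sD g b y Dgᵇ)
  ... | Bézout.-+ x y eq =
    successor-power sD g (x * a) (∈-resp D (cong (g ^_) (sym eq)) (^-multiple sD g b y Dgᵇ)) (^-multiple sD g a x Dgᵃ)

  outside : ∀ {C S} → C ⊆ S → card C < card S → Σ Carrier λ x → T (S x) × ¬ T (C x)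
  outside {C} {S} C⊆S |C|<|S| with cnt-find elems (λ x → S x ∧ not (C x))
  ... | inj₁ (x , _ , t) = x , T-∧ˡ t , T-not⁻¹ (T-∧ʳ {S x} t)
  ... | inj₂ none = ⊥-elim (<⇒≢ |C|<|S| (sym (begin
    card S                                     ≡⟨ cnt-split elems C⊆S ⟩
    card C + card (λ x → S x ∧ not (C x))      ≡⟨ cong (card C +_) none ⟩
    card C + 0                                 ≡⟨ +-identityʳ _ ⟩
    card C                                     ∎)))
    where open ≡-Reasoning

  card-< : ∀ {C S p} → IsSubgroup C → IsSubgroup S → 1 < p → card C * p ∣ card S → card C < card S
  card-< {C} {S} {p} sC sS p>1 div =
    <-≤-trans (m<m*n (card C) p {{>-nonZero (card-pos C (IsSubgroup.has-e sC))}} p>1)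
              (∣⇒≤ {{>-nonZero (card-pos S (IsSubgroup.has-e sS))}} div)

  record PrimeStep (C S : Subset) (p : ℕ) : Set where
    field
      elt        : Carrier
      in-S       : T (S elt)
      not-in-C   : ¬ T (C elt)
      power-in-C : T (C (elt ^ p))

  -- If p divides the order r of x ∈ S modulo C, then x^(r/p) is such an element.
  divisible-step : ∀ {C S x p} → IsSubgroup S → T (S x) → Prime p →
                   (o : OrderModulo C x) → p ∣ OrderModulo.order o → PrimeStep C S p
  divisible-step {C} {S} {x} {p} sS Sx pp o (divides q r≡qp) = record
    { elt        = x ^ q
    ; in-S       = ^-closed sS x q Sx
    ; not-in-C   = below-out q 0<q q<r
    ; power-in-C = ∈-resp C (trans (cong (x ^_) (trans r≡qp (*-comm q p))) (sym (^-* x q p))) power-in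
    }
    where
    open OrderModulo o
    positive : ∀ q → order ≡ q * p → 0 < q
    positive (suc _) _ = z<s
    0<q : 0 < q
    0<q = positive q r≡qp
    q<r : q < order
    q<r = subst (q <_) (sym r≡qp) (m<m*n q p {{>-nonZero 0<q}} (prime>1 pp))

  -- An element g ∉ C with g^p ∈ C, p prime, has order exactly p modulo C:
  -- by Bézout, g^i ∈ C with 0 < i < p would already put g in C.
  prime-order : ∀ {C S p} → IsSubgroup C → Prime p → (step : PrimeStep C S p) →
                Σ (OrderModulo C (PrimeStep.elt step)) λ o → OrderModulo.order o ≡ p
  prime-order {p = zero} sC pp step with prime>1 pp
  ... | ()
  prime-order {C} {p = suc p′} sC pp step =
    record { pred-order = p′ ; power-in = power-in-C ; below-out = below } , refl
    where
    open PrimeStep step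
    below : ∀ i → 0 < i → i < suc p′ → ¬ T (C (elt ^ i))
    below i 0<i i<p Cgⁱ = not-in-C (coprime-powers sC elt i (suc p′)
      (Coprime.sym (prime⇒coprime pp {{>-nonZero 0<i}} i<p)) Cgⁱ power-in-C)

  record Intermediate (C S : Subset) (m : ℕ) : Set where
    field
      K          : Subset
      K-subgroup : IsSubgroup K
      C⊆K        : C ⊆ K
      K⊆S        : K ⊆ S
      card-K     : card K ≡ m

-- Finite abelian groups.

module FinAbelianTheory (𝔾 : FinGroup) (comm : ∀ x y → FinGroup._∙_ 𝔾 x y ≡ FinGroup._∙_ 𝔾 y x) where
  open FinGroupTheory 𝔾

  abelianGroup : AbelianGroup _ _
  abelianGroup = record { isAbelianGroup = record { isGroup = isGroup ; comm = comm } }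

  open AbelianGroupProperties abelianGroup using (⁻¹-∙-comm)
  open CommutativeSemigroupProperties (AbelianGroup.commutativeSemigroup abelianGroup) using (interchange)

  module Congruence {C : Subset} (sC : IsSubgroup C) where
    open IsSubgroup sC

    infix 4 _≈_
    _≈_ : Carrier → Carrier → Set
    y ≈ z = T (C (y ∙ z ⁻¹))

    ≈-refl : ∀ {y} → y ≈ y
    ≈-refl {y} = ∈-resp C (sym (inverseʳ y)) has-e

    ≈-sym : ∀ {y z} → y ≈ z → z ≈ y
    ≈-sym {y} {z} y≈z = ∈-resp C (trans (sym (⁻¹-∙-comm y (z ⁻¹))) (trans (cong (y ⁻¹ ∙_) (⁻¹-involutive z)) (comm _ _)))
                                 (inv-cl _ y≈z)

    ≈-trans : ∀ {y z w} → y ≈ z → z ≈ w → y ≈ w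
    ≈-trans {y} {z} {w} y≈z z≈w = ∈-resp C (trans (assoc _ _ _) (cong (y ∙_) (\\-leftDividesʳ z (w ⁻¹))))
                                           (mul-cl _ _ y≈z z≈w)

    ≈-∙ : ∀ {y z a b} → y ≈ a → z ≈ b → y ∙ z ≈ a ∙ b
    ≈-∙ {y} {z} {a} {b} y≈a z≈b = ∈-resp C (trans (sym (interchange y z (a ⁻¹) (b ⁻¹))) (cong (y ∙ z ∙_) (⁻¹-∙-comm a b)))
                                           (mul-cl _ _ y≈a z≈b)

    ≈-⁻¹ : ∀ {y a} → y ≈ a → y ⁻¹ ≈ a ⁻¹
    ≈-⁻¹ {y} {a} y≈a = ∈-resp C (sym (⁻¹-∙-comm y (a ⁻¹))) (inv-cl _ y≈a)

    ≈-^ : ∀ {y a} i → y ≈ a → y ^ i ≈ a ^ i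
    ≈-^ zero    y≈a = ≈-refl
    ≈-^ (suc i) y≈a = ≈-∙ y≈a (≈-^ i y≈a)

    ∈⇒≈ε : ∀ {y} → T (C y) → y ≈ ε
    ∈⇒≈ε {y} Cy = ∈-resp C (sym (trans (cong (y ∙_) ε⁻¹≈ε) (identityʳ y))) Cy

    ≈ε⇒∈ : ∀ {y} → y ≈ ε → T (C y)
    ≈ε⇒∈ {y} y≈ε = ∈-resp C (trans (cong (y ∙_) ε⁻¹≈ε) (identityʳ y)) y≈ε

    ≈-inverse : ∀ {y z} → y ∙ z ≈ ε → y ⁻¹ ≈ z
    ≈-inverse {y} {z} yz≈ε = subst₂ _≈_ (identityʳ (y ⁻¹)) (\\-leftDividesʳ y z) (≈-∙ (≈-refl {y ⁻¹}) (≈-sym yz≈ε))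

    ≈-transport : ∀ {S} → C ⊆ S → IsSubgroup S → ∀ {y z} → y ≈ z → T (S z) → T (S y)
    ≈-transport {S} C⊆S sS {y} {z} y≈z Sz = ∈-resp S (//-rightDividesˡ z y) (IsSubgroup.mul-cl sS _ _ (C⊆S _ y≈z) Sz)

  -- The subgroup C⟨g⟩ = C ∪ gC ∪ ⋯ ∪ g^(r-1)C, r the order of g modulo C.
  module Adjoin {C : Subset} (sC : IsSubgroup C) (g : Carrier) (o : OrderModulo C g) where
    open OrderModulo o
    open Congruence sC

    shifted : ℕ → Subset
    shifted i y = C (y ∙ (g ^ i) ⁻¹)

    cosetsBelow : ℕ → Subset
    cosetsBelow zero    y = false
    cosetsBelow (suc m) y = cosetsBelow m y ∨ shifted m y

    adjoin : Subset
    adjoin = cosetsBelow order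

    cosetsBelow⁻ : ∀ m {y} → T (cosetsBelow m y) → Σ ℕ λ i → i < m × y ≈ g ^ i
    cosetsBelow⁻ (suc m) {y} t with Equivalence.to (T-∨ {cosetsBelow m y}) t
    ... | inj₁ earlier = let (i , i<m , y≈gⁱ) = cosetsBelow⁻ m earlier in i , m<n⇒m<1+n i<m , y≈gⁱ
    ... | inj₂ y≈gᵐ    = m , ≤-refl , y≈gᵐ

    cosetsBelow⁺ : ∀ m {y} i → i < m → y ≈ g ^ i → T (cosetsBelow m y)
    cosetsBelow⁺ (suc m) {y} i i<1+m y≈gⁱ with m<1+n⇒m<n∨m≡n i<1+m
    ... | inj₁ i<m  = Equivalence.from (T-∨ {cosetsBelow m y}) (inj₁ (cosetsBelow⁺ m i i<m y≈gⁱ))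
    ... | inj₂ refl = Equivalence.from (T-∨ {cosetsBelow m y}) (inj₂ y≈gⁱ)

    -- g^(q r) ∈ C, hence exponents only matter modulo r.
    power-cycle : ∀ q → g ^ (q * order) ≈ ε
    power-cycle q = ∈⇒≈ε (^-multiple sC g order q power-in)

    reduce : ∀ k → g ^ k ≈ g ^ (k % order)
    reduce k = subst₂ _≈_ (sym (trans (cong (g ^_) (m≡m%n+[m/n]*n k order)) (^-+ g (k % order) _))) (identityʳ (g ^ (k % order)))
                          (≈-∙ ≈-refl (power-cycle (k / order)))

    adjoin⁺ : ∀ {y} k → y ≈ g ^ k → T (adjoin y)
    adjoin⁺ k y≈gᵏ = cosetsBelow⁺ order (k % order) (m%n<n k order) (≈-trans y≈gᵏ (reduce k))

    -- g^i g^((r-1) i) = g^(r i) ∈ C.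
    inverse-power : ∀ i → (g ^ i) ⁻¹ ≈ g ^ (pred-order * i)
    inverse-power i = ≈-inverse (subst (_≈ ε) (trans (cong (g ^_) (*-comm i order)) (^-+ g i _)) (power-cycle i))

    -- Closure: exponents add under products and negate under inverses.
    adjoin-subgroup : IsSubgroup adjoin
    adjoin-subgroup = record
      { has-e  = adjoin⁺ 0 ≈-refl
      ; mul-cl = λ y z adj-y adj-z →
          let (i , _ , y≈gⁱ) = cosetsBelow⁻ order adj-y ; (j , _ , z≈gʲ) = cosetsBelow⁻ order adj-z
          in adjoin⁺ (i + j) (subst (y ∙ z ≈_) (sym (^-+ g i j)) (≈-∙ y≈gⁱ z≈gʲ))
      ; inv-cl = λ y adj-y →
          let (i , _ , y≈gⁱ) = cosetsBelow⁻ order adj-y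
          in adjoin⁺ (pred-order * i) (≈-trans (≈-⁻¹ y≈gⁱ) (inverse-power i))
      }

    C⊆adjoin : C ⊆ adjoin
    C⊆adjoin y Cy = adjoin⁺ 0 (∈⇒≈ε Cy)

    adjoin-least : ∀ {S} → IsSubgroup S → C ⊆ S → T (S g) → adjoin ⊆ S
    adjoin-least sS C⊆S Sg y adj-y =
      let (i , _ , y≈gⁱ) = cosetsBelow⁻ order adj-y in ≈-transport C⊆S sS y≈gⁱ (^-closed sS g i Sg)

    -- Distinct cosets g^i C, g^m C (i < m < r) are disjoint, by minimality of r.
    cosets-disjoint : ∀ m → m < order → ∀ y → T (cosetsBelow m y) → T (shifted m y) → ⊥
    cosets-disjoint m m<r y earlier y≈gᵐ with cosetsBelow⁻ m earlier
    ... | i , i<m , y≈gⁱ =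
      below-out (m ∸ i) (m<n⇒0<n∸m i<m) (≤-<-trans (m∸n≤m m i) m<r) (∈-resp C difference (≈-trans (≈-sym y≈gᵐ) y≈gⁱ))
      where
      difference : g ^ m ∙ (g ^ i) ⁻¹ ≡ g ^ (m ∸ i)
      difference = trans (cong (λ k → g ^ k ∙ (g ^ i) ⁻¹) (sym (m∸n+n≡m (<⇒≤ i<m))))
                         (trans (cong (_∙ (g ^ i) ⁻¹) (^-+ g (m ∸ i) i)) (//-rightDividesʳ _ _))

    -- Each coset has |C| elements, so |C⟨g⟩| = r |C|.
    card-shifted : ∀ i → card (shifted i) ≡ card C
    card-shifted i = trans (cnt-cong elems (λ y → cong C (comm y ((g ^ i) ⁻¹)))) (card-translate ((g ^ i) ⁻¹) C)

    card-cosetsBelow : ∀ m → m ≤ order → card (cosetsBelow m) ≡ m * card C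
    card-cosetsBelow zero    _   = cnt-none elems (All.universal (λ _ ()) elems)
    card-cosetsBelow (suc m) m<r = begin
      card (cosetsBelow (suc m))             ≡⟨ cnt-∨ elems (cosets-disjoint m m<r) ⟩
      card (cosetsBelow m) + card (shifted m) ≡⟨ cong₂ _+_ (card-cosetsBelow m (<⇒≤ m<r)) (card-shifted m) ⟩
      m * card C + card C                    ≡⟨ +-comm (m * card C) _ ⟩
      suc m * card C                         ∎
      where open ≡-Reasoning

    card-adjoin : card adjoin ≡ order * card C
    card-adjoin = card-cosetsBelow order ≤-refl

    -- When gcd(r, p) = 1, a prime step over C⟨g⟩ yields one over C: if
    -- h ∉ C⟨g⟩ and h^p ∈ C⟨g⟩, then h^r ∉ C (Bézout) while (h^r)^p ∈ C.
    descend : ∀ {S p} → IsSubgroup S → Coprime order p → PrimeStep adjoin S p → PrimeStep C S p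
    descend {S} {p} sS r⊥p step = record
      { elt        = h ^ order
      ; in-S       = ^-closed sS h order in-S
      ; not-in-C   = λ C-hʳ → not-in-C (coprime-powers adjoin-subgroup h order p r⊥p (C⊆adjoin _ C-hʳ) power-in-C)
      ; power-in-C = hʳᵖ∈C
      }
      where
      open PrimeStep step renaming (elt to h)
      swap : (h ^ p) ^ order ≡ (h ^ order) ^ p
      swap = trans (^-* h p order) (trans (cong (h ^_) (*-comm order p)) (sym (^-* h order p)))
      hʳᵖ∈C : T (C ((h ^ order) ^ p))
      hʳᵖ∈C with cosetsBelow⁻ order power-in-C
      ... | i , _ , hᵖ≈gⁱ = ≈ε⇒∈ (subst (_≈ ε) swap (≈-trans (≈-^ order hᵖ≈gⁱ) gⁱʳ≈ε))
        where
        gⁱʳ≈ε : (g ^ i) ^ order ≈ ε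
        gⁱʳ≈ε = subst (_≈ ε) (trans (cong (g ^_) (*-comm i order)) (sym (^-* g i order))) (power-cycle i)

  -- Take
  -- x ∈ S ∖ C of order r modulo C; if p ∣ r use `divisible-step`, otherwise
  -- recurse on C⟨x⟩ (whose index is still divisible by p) and `descend`.
  -- The gap |S| - |C| shrinks, bounding the recursion.
  cauchy : ∀ gap {C S} → IsSubgroup C → IsSubgroup S → C ⊆ S → card S ∸ card C < gap →
           ∀ {p} → Prime p → card C * p ∣ card S → PrimeStep C S p
  cauchy zero _ _ _ () _ _
  cauchy (suc gap) {C} {S} sC sS C⊆S gap-bound {p} pp |C|p∣|S|
    with outside C⊆S (card-< sC sS (prime>1 pp) |C|p∣|S|)
  ... | x , Sx , ¬Cx with orderModulo sC x
  ... | o with p ∣? OrderModulo.order o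
  ... | yes p∣r = divisible-step sS Sx pp o p∣r
  ... | no p∤r  = descend sS r⊥p (cauchy gap adjoin-subgroup sS adjoin⊆S smaller-gap pp |C⟨x⟩|p∣|S|)
    where
    open OrderModulo o using (order)
    open Adjoin sC x o
    |C|≢0 : NonZero (card C)
    |C|≢0 = >-nonZero (card-pos C (IsSubgroup.has-e sC))
    r⊥p : Coprime order p
    r⊥p (d∣r , d∣p) = [ id , (λ { refl → ⊥-elim (p∤r d∣r) }) ]′ (prime⇒irreducible pp d∣p)
    adjoin⊆S : adjoin ⊆ S
    adjoin⊆S = adjoin-least sS C⊆S Sx
    |C|<|C⟨x⟩| : card C < card adjoin
    |C|<|C⟨x⟩| = subst (card C <_) (trans (*-comm (card C) order) (sym card-adjoin))
                       (m<m*n (card C) order {{|C|≢0}} (order>1 ¬Cx o))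
    smaller-gap : card S ∸ card adjoin < gap
    smaller-gap = <-≤-trans (∸-monoʳ-< |C|<|C⟨x⟩| (card-mono adjoin⊆S)) (≤-pred gap-bound)
    |C⟨x⟩|p∣|S| : card adjoin * p ∣ card S
    |C⟨x⟩|p∣|S| = subst (λ c → c * p ∣ card S) (sym card-adjoin)
      (coprime-combine order (card C) p (card S) {{|C|≢0}} r⊥p
        (subst (_∣ card S) card-adjoin (lagrange adjoin-subgroup sS adjoin⊆S)) |C|p∣|S|)

  -- The converse of Lagrange relative to C ⊆ S, along a list of primes:
  -- each prime p yields (Cauchy) g with C⟨g⟩ of size p |C|, and we recurse.
  extend-by-primes : ∀ ps → All Prime ps → ∀ {C S} → IsSubgroup C → IsSubgroup S → C ⊆ S →
                     card C * product ps ∣ card S → Intermediate C S (card C * product ps)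
  extend-by-primes [] [] {C} sC sS C⊆S _ = record
    { K = C ; K-subgroup = sC ; C⊆K = λ _ Cy → Cy ; K⊆S = C⊆S ; card-K = sym (*-identityʳ _) }
  extend-by-primes (p ∷ ps) (pp ∷ pps) {C} {S} sC sS C⊆S |C|pΠ∣|S| = record
    { K = K ; K-subgroup = K-subgroup ; C⊆K = λ y Cy → C⊆K y (C⊆adjoin y Cy) ; K⊆S = K⊆S
    ; card-K = trans card-K regroup }
    where
    step : PrimeStep C S p
    step = cauchy (suc (card S)) sC sS C⊆S (s≤s (m∸n≤m (card S) (card C))) pp
                  (∣-trans (*-monoʳ-∣ (card C) (m∣m*n (product ps))) |C|pΠ∣|S|)
    order-p : Σ (OrderModulo C (PrimeStep.elt step)) λ o → OrderModulo.order o ≡ p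
    order-p = prime-order sC pp step
    open Adjoin sC (PrimeStep.elt step) (proj₁ order-p)
    regroup : card adjoin * product ps ≡ card C * (p * product ps)
    regroup = begin
      card adjoin * product ps
        ≡⟨ cong (_* product ps) card-adjoin ⟩
      OrderModulo.order (proj₁ order-p) * card C * product ps
        ≡⟨ cong (λ r → r * card C * product ps) (proj₂ order-p) ⟩
      p * card C * product ps
        ≡⟨ cong (_* product ps) (*-comm p (card C)) ⟩
      card C * p * product ps
        ≡⟨ *-assoc (card C) p _ ⟩
      card C * (p * product ps) ∎
      where open ≡-Reasoning
    open Intermediate (extend-by-primes ps pps adjoin-subgroup sS (adjoin-least sS C⊆S (PrimeStep.in-S step))
                                        (subst (_∣ card S) (sym regroup) |C|pΠ∣|S|))

  -- Converse of Lagrange for finite abelian groups, relative to C ⊆ S: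
  -- factor t into primes (t ≠ 0 since |S| ≠ 0) and extend prime by prime.
  extend : ∀ t {C S} → IsSubgroup C → IsSubgroup S → C ⊆ S → card C * t ∣ card S → Intermediate C S (card C * t)
  extend zero {C} {S} sC sS C⊆S |C|0∣|S| =
    ⊥-elim (<⇒≢ (card-pos S (IsSubgroup.has-e sS)) (sym (0∣⇒≡0 (subst (_∣ card S) (*-zeroʳ (card C)) |C|0∣|S|))))
  extend t@(suc _) {C} {S} sC sS C⊆S |C|t∣|S| =
    subst (Intermediate C S) (cong (card C *_) (sym isFactorisation))
      (extend-by-primes factors factorsPrime sC sS C⊆S (subst (λ u → card C * u ∣ card S) isFactorisation |C|t∣|S|))
    where open PrimeFactorisation (factorise t)

-- ℤ/nℤ.  Addition modulo n makes Fin n a finite abelian group.  Every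
-- additive map f on it is multiplication by the constant f(1), so every
-- automorphism maps every subgroup into itself.

module CyclicGroup (n : ℕ) .{{_ : NonZero n}} where
  open ZMod n

  toℕ-mod : ∀ m → toℕ (m mod n) ≡ m % n
  toℕ-mod m = toℕ-fromℕ< (m%n<n m n)

  toℕ-0ₙ : toℕ 0ₙ ≡ 0
  toℕ-0ₙ = n≤0⇒n≡0 (subst (_≤ 0) (sym (toℕ-mod 0)) (m%n≤m 0 n))

  toℕ-% : ∀ (x : Fin n) → toℕ x % n ≡ toℕ x
  toℕ-% x = m<n⇒m%n≡m (toℕ<n x)

  %-absorbˡ : ∀ a b → (a % n + b) % n ≡ (a + b) % n
  %-absorbˡ a b = trans (%-distribˡ-+ (a % n) b n)
    (trans (cong (λ z → (z + b % n) % n) (m%n%n≡m%n a n)) (sym (%-distribˡ-+ a b n)))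

  %-absorbʳ : ∀ a b → (a + b % n) % n ≡ (a + b) % n
  %-absorbʳ a b = trans (cong (_% n) (+-comm a (b % n))) (trans (%-absorbˡ b a) (cong (_% n) (+-comm b a)))

  +ₙ-assoc : ∀ x y z → (x +ₙ y) +ₙ z ≡ x +ₙ (y +ₙ z)
  +ₙ-assoc x y z = toℕ-injective (begin
    toℕ ((x +ₙ y) +ₙ z)                 ≡⟨ toℕ-mod _ ⟩
    (toℕ (x +ₙ y) + toℕ z) % n          ≡⟨ cong (λ w → (w + toℕ z) % n) (toℕ-mod _) ⟩
    ((toℕ x + toℕ y) % n + toℕ z) % n   ≡⟨ %-absorbˡ _ _ ⟩
    (toℕ x + toℕ y + toℕ z) % n         ≡⟨ cong (_% n) (+-assoc (toℕ x) _ _) ⟩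
    (toℕ x + (toℕ y + toℕ z)) % n       ≡⟨ %-absorbʳ _ _ ⟨
    (toℕ x + (toℕ y + toℕ z) % n) % n   ≡⟨ cong (λ w → (toℕ x + w) % n) (toℕ-mod _) ⟨
    (toℕ x + toℕ (y +ₙ z)) % n          ≡⟨ toℕ-mod _ ⟨
    toℕ (x +ₙ (y +ₙ z))                 ∎)
    where open ≡-Reasoning

  +ₙ-comm : ∀ x y → x +ₙ y ≡ y +ₙ x
  +ₙ-comm x y = cong (_mod n) (+-comm (toℕ x) (toℕ y))

  +ₙ-identityˡ : ∀ x → 0ₙ +ₙ x ≡ x
  +ₙ-identityˡ x = toℕ-injective (trans (toℕ-mod _) (trans (cong (λ w → (w + toℕ x) % n) toℕ-0ₙ) (toℕ-% x)))

  +ₙ-identityʳ : ∀ x → x +ₙ 0ₙ ≡ x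
  +ₙ-identityʳ x = trans (+ₙ-comm x 0ₙ) (+ₙ-identityˡ x)

  +ₙ-inverseˡ : ∀ x → (-ₙ x) +ₙ x ≡ 0ₙ
  +ₙ-inverseˡ x = toℕ-injective (begin
    toℕ ((-ₙ x) +ₙ x)                  ≡⟨ toℕ-mod _ ⟩
    (toℕ (-ₙ x) + toℕ x) % n           ≡⟨ cong (λ w → (w + toℕ x) % n) (toℕ-mod _) ⟩
    ((n ∸ toℕ x) % n + toℕ x) % n      ≡⟨ %-absorbˡ _ _ ⟩
    (n ∸ toℕ x + toℕ x) % n            ≡⟨ cong (_% n) (m∸n+n≡m (<⇒≤ (toℕ<n x))) ⟩
    n % n                              ≡⟨ n%n≡0 n ⟩
    0                                  ≡⟨ toℕ-0ₙ ⟨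
    toℕ 0ₙ                             ∎)
    where open ≡-Reasoning

  ℤₙ : FinGroup
  ℤₙ = record
    { Carrier = Fin n ; _∙_ = _+ₙ_ ; ε = 0ₙ ; _⁻¹ = -ₙ_
    ; isGroup = isGroup-≡ +ₙ-assoc +ₙ-identityˡ +ₙ-identityʳ +ₙ-inverseˡ (λ x → trans (+ₙ-comm x _) (+ₙ-inverseˡ x))
    ; elems = allFin n ; elems-unique = Unique.allFin⁺ n ; elems-complete = ∈-allFin
    }

  open FinGroupTheory ℤₙ using (_^_; ^-*; ^-closed; IsSubgroup; ∙-cancelˡ)

  1ₙ : Fin n
  1ₙ = 1 mod n

  toℕ-1ₙ^ : ∀ j → toℕ (1ₙ ^ j) ≡ j % n
  toℕ-1ₙ^ zero    = toℕ-mod 0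
  toℕ-1ₙ^ (suc j) = begin
    toℕ (1ₙ +ₙ (1ₙ ^ j))              ≡⟨ toℕ-mod _ ⟩
    (toℕ 1ₙ + toℕ (1ₙ ^ j)) % n       ≡⟨ cong₂ (λ a b → (a + b) % n) (toℕ-mod 1) (toℕ-1ₙ^ j) ⟩
    (1 % n + j % n) % n               ≡⟨ %-distribˡ-+ 1 j n ⟨
    suc j % n                         ∎
    where open ≡-Reasoning

  1ₙ^toℕ : ∀ y → 1ₙ ^ toℕ y ≡ y
  1ₙ^toℕ y = toℕ-injective (trans (toℕ-1ₙ^ (toℕ y)) (toℕ-% y))

  Additive : (Fin n → Fin n) → Set
  Additive f = ∀ x y → f (x +ₙ y) ≡ f x +ₙ f y

  additive-0 : ∀ f → Additive f → f 0ₙ ≡ 0ₙ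
  additive-0 f additive = sym (∙-cancelˡ (f 0ₙ) _ _
    (trans (+ₙ-identityʳ (f 0ₙ)) (trans (cong f (sym (+ₙ-identityˡ 0ₙ))) (additive 0ₙ 0ₙ))))

  additive-^ : ∀ f → Additive f → ∀ y j → f (y ^ j) ≡ f y ^ j
  additive-^ f additive y zero    = additive-0 f additive
  additive-^ f additive y (suc j) = trans (additive y _) (cong (f y +ₙ_) (additive-^ f additive y j))

  additive-scaling : ∀ f → Additive f → ∀ y → f y ≡ y ^ toℕ (f 1ₙ)
  additive-scaling f additive y = begin
    f y                ≡⟨ cong f (1ₙ^toℕ y) ⟨
    f (1ₙ ^ toℕ y)     ≡⟨ additive-^ f additive 1ₙ (toℕ y) ⟩
    f 1ₙ ^ toℕ y       ≡⟨ cong (_^ toℕ y) (1ₙ^toℕ (f 1ₙ)) ⟨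
    (1ₙ ^ c) ^ toℕ y   ≡⟨ ^-* 1ₙ c (toℕ y) ⟩
    1ₙ ^ (toℕ y * c)   ≡⟨ cong (1ₙ ^_) (*-comm (toℕ y) c) ⟩
    1ₙ ^ (c * toℕ y)   ≡⟨ ^-* 1ₙ (toℕ y) c ⟨
    (1ₙ ^ toℕ y) ^ c   ≡⟨ cong (_^ c) (1ₙ^toℕ y) ⟩
    y ^ c              ∎
    where
    open ≡-Reasoning
    c : ℕ
    c = toℕ (f 1ₙ)

  additive-invariant : ∀ f {N} → Additive f → IsSubgroup N → ∀ y → T (N y) → T (N (f y))
  additive-invariant f {N} additive sN y Ny =
    subst (λ z → T (N z)) (sym (additive-scaling f additive y)) (^-closed sN y (toℕ (f 1ₙ)) Ny)

module SemidirectGroup (n : ℕ) .{{_ : NonZero n}} {k : ℕ} (A : FinAbGroup k) (Φ : AutHom n A) where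
  open ZMod n using (0ₙ; _+ₙ_; -ₙ_)
  open Semidirect n A Φ
  open AutHom Φ
  open CyclicGroup n using (ℤₙ; +ₙ-assoc; +ₙ-comm; +ₙ-identityˡ; +ₙ-identityʳ; +ₙ-inverseˡ; additive-0; additive-invariant)
  open FinAbGroup A using (_∙_; ε; _⁻¹; isAbelianGroup)
  open IsAbelianGroup isAbelianGroup using (isGroup; comm)
    renaming (assoc to ∙-assoc; identityˡ to ∙-identityˡ; identityʳ to ∙-identityʳ; inverseˡ to ∙-inverseˡ; inverseʳ to ∙-inverseʳ)

  𝔸 : FinGroup
  𝔸 = record
    { Carrier = Fin k ; _∙_ = _∙_ ; ε = ε ; _⁻¹ = _⁻¹ ; isGroup = isGroup
    ; elems = allFin k ; elems-unique = Unique.allFin⁺ k ; elems-complete = ∈-allFin }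

  module ℤᵍ = FinGroupTheory ℤₙ
  module 𝔸ᵍ = FinGroupTheory 𝔸

  φ-0 : ∀ a → φ a 0ₙ ≡ 0ₙ
  φ-0 a = additive-0 (φ a) (IsAut.additive (isAut a))

  φ-ε : ∀ x → φ ε x ≡ x
  φ-ε x = proj₁ (IsAut.bijective (isAut ε)) (trans (sym (hom ε ε x)) (cong (λ c → φ c x) (∙-identityˡ ε)))

  φ-neg : ∀ a y → φ a (-ₙ y) ≡ -ₙ (φ a y)
  φ-neg a y = ℤᵍ.inverseʳ-unique (φ a y) (φ a (-ₙ y))
    (trans (sym (IsAut.additive (isAut a) y (-ₙ y))) (trans (cong (φ a) (ℤᵍ.inverseʳ y)) (φ-0 a)))

  ·-assoc : ∀ g h l → (g · h) · l ≡ g · (h · l)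
  ·-assoc (x , a) (y , b) (z , c) = cong₂ _,_ (begin
    (x +ₙ φ a y) +ₙ φ (a ∙ b) z   ≡⟨ +ₙ-assoc x (φ a y) _ ⟩
    x +ₙ (φ a y +ₙ φ (a ∙ b) z)   ≡⟨ cong (λ w → x +ₙ (φ a y +ₙ w)) (hom a b z) ⟩
    x +ₙ (φ a y +ₙ φ a (φ b z))   ≡⟨ cong (x +ₙ_) (IsAut.additive (isAut a) y (φ b z)) ⟨
    x +ₙ φ a (y +ₙ φ b z)         ∎) (∙-assoc a b c)
    where open ≡-Reasoning

  ·-inverseʳ : ∀ g → g · inv g ≡ e
  ·-inverseʳ (x , a) = cong₂ _,_ (begin
    x +ₙ φ a (-ₙ φ (a ⁻¹) x)   ≡⟨ cong (x +ₙ_) (φ-neg a _) ⟩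
    x +ₙ (-ₙ φ a (φ (a ⁻¹) x)) ≡⟨ cong (λ w → x +ₙ (-ₙ w)) (hom a (a ⁻¹) x) ⟨
    x +ₙ (-ₙ φ (a ∙ (a ⁻¹)) x) ≡⟨ cong (λ c → x +ₙ (-ₙ φ c x)) (∙-inverseʳ a) ⟩
    x +ₙ (-ₙ φ ε x)            ≡⟨ cong (λ w → x +ₙ (-ₙ w)) (φ-ε x) ⟩
    x +ₙ (-ₙ x)                ≡⟨ ℤᵍ.inverseʳ x ⟩
    0ₙ                         ∎) (∙-inverseʳ a)
    where open ≡-Reasoning

  𝔾 : FinGroup
  𝔾 = record
    { Carrier = G ; _∙_ = _·_ ; ε = e ; _⁻¹ = inv
    ; isGroup = isGroup-≡ ·-assoc
        (λ { (x , a) → cong₂ _,_ (trans (+ₙ-identityˡ _) (φ-ε x)) (∙-identityˡ a) })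
        (λ { (x , a) → cong₂ _,_ (trans (cong (x +ₙ_) (φ-0 a)) (+ₙ-identityʳ x)) (∙-identityʳ a) })
        (λ { (x , a) → cong₂ _,_ (+ₙ-inverseˡ _) (∙-inverseˡ a) })
        ·-inverseʳ
    ; elems = elems
    ; elems-unique = Unique.cartesianProduct⁺ (Unique.allFin⁺ n) (Unique.allFin⁺ k)
    ; elems-complete = λ { (x , a) → ∈-cartesianProduct⁺ (∈-allFin x) (∈-allFin a) }
    }

  module 𝔾ᵍ = FinGroupTheory 𝔾

  toSubgroup : ∀ {S} → IsSubgroup S → 𝔾ᵍ.IsSubgroup S
  toSubgroup sS = record { has-e = has-e ; mul-cl = mul-cl ; inv-cl = inv-cl }
    where open IsSubgroup sS

  module ℤᵃ = FinAbelianTheory ℤₙ +ₙ-comm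
  module 𝔸ᵃ = FinAbelianTheory 𝔸 comm

  -- Product subsets.  N ⊗ B is a subgroup whenever N and B are, because
  -- every φ a maps N into itself.
  _⊗_ : (Fin n → Bool) → (Fin k → Bool) → SubsetG
  (N ⊗ B) g = N (proj₁ g) ∧ B (proj₂ g)

  ⊗-subgroup : ∀ {N B} → ℤᵍ.IsSubgroup N → 𝔸ᵍ.IsSubgroup B → IsSubgroup (N ⊗ B)
  ⊗-subgroup {N} {B} sN sB = record
    { has-e  = T-∧ N.has-e B.has-e
    ; mul-cl = λ { (x , a) (y , b) t u →
        T-∧ (N.mul-cl x (φ a y) (T-∧ˡ t) (φ-invariant a y (T-∧ˡ u))) (B.mul-cl a b (T-∧ʳ {N x} t) (T-∧ʳ {N y} u)) }
    ; inv-cl = λ { (x , a) t →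
        T-∧ (N.inv-cl _ (φ-invariant (a ⁻¹) x (T-∧ˡ t))) (B.inv-cl a (T-∧ʳ {N x} t)) }
    }
    where
    module N = ℤᵍ.IsSubgroup sN
    module B = 𝔸ᵍ.IsSubgroup sB
    φ-invariant : ∀ a y → T (N y) → T (N (φ a y))
    φ-invariant a = additive-invariant (φ a) (IsAut.additive (isAut a)) sN

  card-⊗ : ∀ N B → card (N ⊗ B) ≡ ℤᵍ.card N * 𝔸ᵍ.card B
  card-⊗ N B = cnt-× (allFin n) (allFin k) N B

  Overgroup : SubsetG → ℕ → Set
  Overgroup H m = Σ SubsetG (λ K → IsSubgroup K × H ⊆ K × card K ≡ m)

  overgroup-order : ∀ {H m} → IsSubgroup H → Overgroup H m → m ≥ 1 × card H ∣ m × m ∣ card fullG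
  overgroup-order sH (K , sK , H⊆K , refl) =
    𝔾ᵍ.card-pos K (IsSubgroup.has-e sK) ,
    𝔾ᵍ.lagrange (toSubgroup sH) (toSubgroup sK) H⊆K ,
    𝔾ᵍ.lagrange (toSubgroup sK) 𝔾ᵍ.full-subgroup (λ _ _ → _)

  -- If H ⊆ N ⊗ B, then for |N| t ∣ n and |B| u ∣ |A| there is an overgroup of H
  -- with (|N| t)(|B| u) elements: N′ ⊗ B′, with N ⊆ N′ and B ⊆ B′ given by the
  -- converse of Lagrange in the abelian groups ℤ/nℤ and A.
  overgroups-of-product : ∀ {H N B} → H ⊆ (N ⊗ B) → ℤᵍ.IsSubgroup N → 𝔸ᵍ.IsSubgroup B →
                          ∀ t u → ℤᵍ.card N * t ∣ ℤᵍ.card ℤᵍ.full → 𝔸ᵍ.card B * u ∣ 𝔸ᵍ.card 𝔸ᵍ.full →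
                          Overgroup H ((ℤᵍ.card N * t) * (𝔸ᵍ.card B * u))
  overgroups-of-product {H} {N} {B} H⊆N⊗B sN sB t u |N|t∣n |B|u∣k =
    N′.K ⊗ B′.K , ⊗-subgroup N′.K-subgroup B′.K-subgroup , H⊆N′⊗B′ ,
    trans (card-⊗ N′.K B′.K) (cong₂ _*_ N′.card-K B′.card-K)
    where
    module N′ = ℤᵍ.Intermediate (ℤᵃ.extend t sN ℤᵍ.full-subgroup (λ _ _ → _) |N|t∣n)
    module B′ = 𝔸ᵍ.Intermediate (𝔸ᵃ.extend u sB 𝔸ᵍ.full-subgroup (λ _ _ → _) |B|u∣k)
    H⊆N′⊗B′ : H ⊆ (N′.K ⊗ B′.K)
    H⊆N′⊗B′ (x , a) Hxa = T-∧ (N′.C⊆K x (T-∧ˡ NBxa)) (B′.C⊆K a (T-∧ʳ {N x} NBxa))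
      where
      NBxa : T ((N ⊗ B) (x , a))
      NBxa = H⊆N⊗B (x , a) Hxa

  H₀ : SubsetG → Fin n → Bool
  H₀ H x = H (x , ε)

  H₀-subgroup : ∀ {H} → IsSubgroup H → ℤᵍ.IsSubgroup (H₀ H)
  H₀-subgroup {H} sH = record
    { has-e  = has-e
    ; mul-cl = λ x y Hx Hy → 𝔾ᵍ.∈-resp H (cong₂ _,_ (cong (x +ₙ_) (φ-ε y)) (∙-identityˡ ε)) (mul-cl _ _ Hx Hy)
    ; inv-cl = λ x Hx → 𝔾ᵍ.∈-resp H (cong₂ _,_ (trans (cong (λ c → -ₙ φ c x) 𝔸ᵍ.ε⁻¹≈ε) (cong -ₙ_ (φ-ε x))) 𝔸ᵍ.ε⁻¹≈ε)
                                    (inv-cl _ Hx)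
    }
    where open IsSubgroup sH

  -- If H ⊇ A then H = H₀ ⊗ A, since (x , a) = (x , ε) · (0 , a).
  containsA-shape : ∀ {H} → IsSubgroup H → ContainsA H → ∀ g → H g ≡ (H₀ H ⊗ 𝔸ᵍ.full) g
  containsA-shape {H} sH H⊇A (x , a) = T-ext
    (λ Hxa → T-∧ (𝔾ᵍ.∈-resp H (cong₂ _,_ (trans (cong (x +ₙ_) (φ-0 a)) (+ₙ-identityʳ x)) (∙-inverseʳ a))
                             (mul-cl (x , a) (0ₙ , a ⁻¹) Hxa (H⊇A (a ⁻¹)))) _)
    (λ Hxε → 𝔾ᵍ.∈-resp H (cong₂ _,_ (trans (cong (x +ₙ_) (φ-0 ε)) (+ₙ-identityʳ x)) (∙-identityˡ a))
                       (mul-cl (x , ε) (0ₙ , a) (T-∧ˡ Hxε) (H⊇A a)))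
    where open IsSubgroup sH

  trivial : Fin k → Bool
  trivial a = ⌊ a ≟ᶠ ε ⌋

  trivial-subgroup : 𝔸ᵍ.IsSubgroup trivial
  trivial-subgroup = record
    { has-e  = fromWitness refl
    ; mul-cl = λ a b a≡ε b≡ε → fromWitness (trans (cong₂ _∙_ (toWitness a≡ε) (toWitness b≡ε)) (∙-identityˡ ε))
    ; inv-cl = λ a a≡ε → fromWitness (trans (cong _⁻¹ (toWitness a≡ε)) 𝔸ᵍ.ε⁻¹≈ε)
    }

  card-trivial : 𝔸ᵍ.card trivial ≡ 1
  card-trivial = cnt-singleton _≟ᶠ_ (allFin k) (Unique.allFin⁺ k) (∈-allFin ε)

  trivialProj-shape : ∀ {H} → TrivialProjA H → ∀ g → H g ≡ (H₀ H ⊗ trivial) g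
  trivialProj-shape {H} proj-trivial (x , a) = T-ext
    (λ Hxa → T-∧ (𝔾ᵍ.∈-resp H (cong (x ,_) (proj-trivial x a Hxa)) Hxa) (fromWitness (proj-trivial x a Hxa)))
    (λ Hxε → 𝔾ᵍ.∈-resp H (cong (x ,_) (sym (toWitness (T-∧ʳ {H₀ H x} Hxε)))) (T-∧ˡ Hxε))

  card-fullG : card fullG ≡ ℤᵍ.card ℤᵍ.full * 𝔸ᵍ.card 𝔸ᵍ.full
  card-fullG = card-⊗ ℤᵍ.full 𝔸ᵍ.full

  -- Case H ⊇ A.  Then |H| = |H₀| |A|, so |H| ∣ m ∣ |G| = n |A| gives
  -- m = (|H₀| w) |A| with |H₀| w ∣ n; enlarge H₀ by the factor w.
  overgroups-containingA : ∀ {H m} → IsSubgroup H → ContainsA H → card H ∣ m → m ∣ card fullG → Overgroup H m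
  overgroups-containingA {H} {m} sH H⊇A |H|∣m m∣|G|
    with cancel-factor {h = ℤᵍ.card (H₀ H)} {{>-nonZero (𝔸ᵍ.card-pos 𝔸ᵍ.full {ε} _)}} (subst (_∣ m) |H|≡ |H|∣m) (subst (m ∣_) card-fullG m∣|G|)
    where
    |H|≡ : card H ≡ ℤᵍ.card (H₀ H) * 𝔸ᵍ.card 𝔸ᵍ.full
    |H|≡ = trans (cnt-cong elems (containsA-shape sH H⊇A)) (card-⊗ _ _)
  ... | w , |H₀|w∣n , m≡ =
    subst (Overgroup H) (sym (trans m≡ (cong (ℤᵍ.card (H₀ H) * w *_) (sym (*-identityʳ _)))))
      (overgroups-of-product (λ g → subst T (containsA-shape sH H⊇A g)) (H₀-subgroup sH) 𝔸ᵍ.full-subgroup w 1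
        |H₀|w∣n (subst (_∣ 𝔸ᵍ.card 𝔸ᵍ.full) (sym (*-identityʳ _)) ∣-refl))

  -- Case H projects trivially to A.  Then |H| = |H₀| divides n, and
  -- |H| ∣ m ∣ n |A| gives m = (|H₀| t) c with |H₀| t ∣ n and c ∣ |A|;
  -- enlarge H₀ by t and {ε} by c.
  overgroups-trivialProj : ∀ {H m} → IsSubgroup H → TrivialProjA H → m ≥ 1 → card H ∣ m → m ∣ card fullG → Overgroup H m
  overgroups-trivialProj {H} {m} sH proj-trivial m≥1 |H|∣m m∣|G|
    with split-divisor {h = ℤᵍ.card (H₀ H)} m≥1 (subst (_∣ m) |H|≡ |H|∣m) |H₀|∣n (subst (m ∣_) card-fullG m∣|G|)
    where
    |H|≡ : card H ≡ ℤᵍ.card (H₀ H)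
    |H|≡ = trans (cnt-cong elems (trivialProj-shape proj-trivial))
                 (trans (card-⊗ _ _) (trans (cong (ℤᵍ.card (H₀ H) *_) card-trivial) (*-identityʳ _)))
    |H₀|∣n : ℤᵍ.card (H₀ H) ∣ ℤᵍ.card ℤᵍ.full
    |H₀|∣n = ℤᵍ.lagrange (H₀-subgroup sH) ℤᵍ.full-subgroup (λ _ _ → _)
  ... | t , c , |H₀|t∣n , c∣|A| , m≡ =
    subst (Overgroup H) (sym (trans m≡ (cong (ℤᵍ.card (H₀ H) * t *_) (sym one-c))))
      (overgroups-of-product (λ g → subst T (trivialProj-shape proj-trivial g)) (H₀-subgroup sH) trivial-subgroup t c
        |H₀|t∣n (subst (_∣ 𝔸ᵍ.card 𝔸ᵍ.full) (sym one-c) c∣|A|))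
    where
    one-c : 𝔸ᵍ.card trivial * c ≡ c
    one-c = trans (cong (_* c) card-trivial) (*-identityˡ c)

lemma3p9 : (n : ℕ) .{{_ : NonZero n}} {k : ℕ} (A : FinAbGroup k) (Φ : AutHom n A)
    → let open Semidirect n A Φ in
    (H : SubsetG) → IsSubgroup H → ContainsA H ⊎ TrivialProjA H
    → (m : ℕ)
    → (Σ SubsetG (λ K → IsSubgroup K × H ⊆ K × card K ≡ m))
    ⇔ (m ≥ 1 × card H ∣ m × m ∣ card fullG)
lemma3p9 n A Φ H sH shape m = mk⇔ (overgroup-order sH) λ (m≥1 , |H|∣m , m∣|G|) →
  [ (λ H⊇A → overgroups-containingA sH H⊇A |H|∣m m∣|G|)
  , (λ proj-trivial → overgroups-trivialProj sH proj-trivial m≥1 |H|∣m m∣|G|)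
  ]′ shape
  where open SemidirectGroup n A Φ
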